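{- Let $G$ be a finite primitive permutation group with a point-stabilizer $H$. If $H$ has a normal Sylow subgroup $P\ne1$, then $P$ is also a Sylow subgroup of $G$. -}

module Defs where

open import Data.Nat using (ℕ; zero; suc; _^_)
open import Data.Nat.Divisibility using (_∣_)
open import Data.Nat.Primality using (Prime)
open import Data.Fin using (Fin; _≟_)
open import Data.Fin.Subset using (Subset; _∈_; _∉_; ∣_∣; ⊤)
open import Data.Vec using (Vec; []; _∷_; lookup; tabulate)
open import Data.List using (List; [_]; map; concatMap; filter; length; allFin)
open import Data.Product using (Σ; ∃; _×_; _,_)
open import Data.Sum using (_⊎_)
open import Relation.Binary.PropositionalEquality using (_≡_; _≢_)
open import Relation.Nullary using (¬_; Dec)
open import Relation.Nullary.Decidable using (_×-dec_)
open import Relation.Unary using (Pred; Decidable)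
open import Level using (0ℓ)

-- A (candidate) permutation of Fin n, as the vector of images: i ↦ lookup σ i.
Perm : ℕ → Set
Perm n = Vec (Fin n) n

_∘ₚ_ : ∀ {n} → Perm n → Perm n → Perm n
σ ∘ₚ τ = tabulate (λ i → lookup σ (lookup τ i))

idₚ : ∀ {n} → Perm n
idₚ = tabulate (λ i → i)

PSet : ℕ → Set₁
PSet n = Pred (Perm n) 0ℓ

vecs : ∀ {A : Set} → List A → (k : ℕ) → List (Vec A k)
vecs xs zero    = [ [] ]
vecs xs (suc k) = concatMap (λ x → map (x ∷_) (vecs xs k)) xs

allMaps : (n : ℕ) → List (Perm n)
allMaps n = vecs (allFin n) n

order : ∀ {n} {S : PSet n} → Decidable S → ℕ
order {n} S? = length (filter S? (allMaps n))

record IsSubgroupOf {n} (K S : PSet n) : Set where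
  field
    ⊆K    : ∀ σ → S σ → K σ
    id∈   : S idₚ
    ∘∈    : ∀ σ τ → S σ → S τ → S (σ ∘ₚ τ)
    inv∈  : ∀ σ → S σ → Σ (Perm n) λ τ → S τ × (σ ∘ₚ τ ≡ idₚ) × (τ ∘ₚ σ ≡ idₚ)

-- A finite permutation group of degree n: a decidable subgroup of Sym(Fin n)
-- (every member has a two-sided inverse, hence is a genuine permutation).
IsPermGroup : ∀ {n} → PSet n → Set
IsPermGroup {n} G = IsSubgroupOf (λ _ → Data.Unit.⊤) G
  where import Data.Unit

IsTransitive : ∀ {n} → PSet n → Set
IsTransitive {n} G = ∀ (i j : Fin n) → Σ (Perm n) λ g → G g × lookup g i ≡ j

-- B is a block: for every g ∈ G, either gB ⊆ B (hence gB = B) or gB ∩ B = ∅.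
IsBlock : ∀ {n} → PSet n → Subset n → Set
IsBlock {n} G B = ∀ g → G g →
  (∀ i → i ∈ B → lookup g i ∈ B) ⊎ (∀ i → i ∈ B → lookup g i ∉ B)

IsPrimitive : ∀ {n} → PSet n → Set
IsPrimitive {n} G = IsTransitive G × (∀ (B : Subset n) → IsBlock G B → (∣ B ∣ Data.Nat.≤ 1) ⊎ (B ≡ ⊤))
  where import Data.Nat

Stab : ∀ {n} → PSet n → Fin n → PSet n
Stab G α σ = G σ × lookup σ α ≡ α

Stab? : ∀ {n} {G : PSet n} → Decidable G → (α : Fin n) → Decidable (Stab G α)
Stab? G? α σ = G? σ ×-dec (lookup σ α ≟ α)

-- N is normal in K: hN = Nh for all h ∈ K (written as hxh⁻¹ ∈ N, i.e. hx = yh with y ∈ N).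
IsNormalIn : ∀ {n} → PSet n → PSet n → Set
IsNormalIn {n} K N = IsSubgroupOf K N ×
  (∀ h x → K h → N x → Σ (Perm n) λ y → N y × (h ∘ₚ x ≡ y ∘ₚ h))

IsSylowOf : ∀ {n} {K P : PSet n} → Decidable K → Decidable P → Set
IsSylowOf {n} {K} {P} K? P? = IsSubgroupOf K P ×
  Σ ℕ λ p → Prime p × Σ ℕ λ a → (order P? ≡ p ^ a) × ¬ (p ^ suc a ∣ order K?)

IsNontrivial : ∀ {n} → PSet n → Set
IsNontrivial {n} P = Σ (Perm n) λ x → P x × x ≢ idₚ

module Submission where

-- The normaliser N = N_G(P) contains H, and the orbit of α under any
-- overgroup of H is a block; by primitivity N fixes α or is transitive, and
-- the latter would force P (which fixes α and is normalised by N) to fix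
-- every point.  So N_G(P) ≤ H.  Counting G by double cosets PgP, where
-- |PgP|·|P ∩ gPg⁻¹| = |P|² = p^(2a), every double coset outside H has size
-- divisible by p^(a+1), whence |G| ≡ |H| (mod p^(a+1)) and p^(a+1) ∤ |G|.

open import Defs
open import Data.Nat using (ℕ; zero; suc; _+_; _*_; _^_; _≤_; _<_; _<?_; z≤n; s≤s; NonZero)
open import Data.Nat.Properties
open import Data.Nat.Divisibility using (_∣_; divides; ∣m+n∣m⇒∣n; n∣m*n)
open import Data.Nat.Primality using (Prime; euclidsLemma; prime⇒nonZero)
open import Data.Nat.Solver using (module +-*-Solver)
open import Data.Fin using (Fin; zero; suc) renaming (_≟_ to _≟ᶠ_)
import Data.Fin.Properties as Finₚ
open import Data.Fin.Subset using (Subset; _∈_; _∉_; ∣_∣; ⊤; ⁅_⁆)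
open import Data.Fin.Subset.Properties using (∈⊤; x∈⁅y⁆⇒x≡y; x≢y⇒x∉⁅y⁆; ∣⁅x⁆∣≡1; p⊂q⇒∣p∣<∣q∣)
open import Data.Vec using (Vec; []; _∷_; lookup; tabulate)
import Data.Vec.Properties as Vecₚ
open import Data.List using (List; []; _∷_; map; concatMap; filter; length; allFin; _++_)
import Data.List.Properties as Listₚ
open import Data.Product using (∃; _×_; _,_; proj₁; proj₂)
open import Data.Sum using (_⊎_; inj₁; inj₂)
open import Function using (_∘_)
open import Level using (0ℓ)
open import Algebra.Bundles using (Monoid)
open import Algebra.Properties.CommutativeSemigroup +-commutativeSemigroup using (interchange)
open import Relation.Nullary using (Dec; yes; no; ¬_; does; contradiction)
open import Relation.Nullary.Decidable using (_×-dec_; ¬?; _→-dec_; dec-true; decidable-stable)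
open import Relation.Unary using (Pred; Decidable; _∩_; ∁)
open import Relation.Unary.Properties using (_∩?_; ∁?)
open import Relation.Binary.Definitions using (DecidableEquality; _Respects_)
open import Relation.Binary.Structures using (IsEquivalence)
open import Relation.Binary.PropositionalEquality

ind : ∀ {P : Set} → Dec P → ℕ
ind (yes _) = 1
ind (no _)  = 0

module _ {P Q : Set} where

  ind-cong : (P → Q) → (Q → P) → (p : Dec P) (q : Dec Q) → ind p ≡ ind q
  ind-cong f g (yes _) (yes _) = refl
  ind-cong f g (yes p) (no ¬q) = contradiction (f p) ¬q
  ind-cong f g (no ¬p) (yes q) = contradiction (g q) ¬p
  ind-cong f g (no _)  (no _)  = refl

  ind-mono : (P → Q) → (p : Dec P) (q : Dec Q) → ind p ≤ ind q
  ind-mono f (yes _) (yes _) = ≤-refl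
  ind-mono f (yes p) (no ¬q) = contradiction (f p) ¬q
  ind-mono f (no _)  q       = z≤n

  ind-× : (p : Dec P) (q : Dec Q) → ind (p ×-dec q) ≡ ind p * ind q
  ind-× (yes _) (yes _) = refl
  ind-× (yes _) (no _)  = refl
  ind-× (no _)  _       = refl

  ind-split : (p : Dec P) (q : Dec Q) → ind p ≡ ind (p ×-dec q) + ind (p ×-dec ¬? q)
  ind-split (yes _) (yes _) = refl
  ind-split (yes _) (no _)  = refl
  ind-split (no _)  _       = refl

ind-yes : ∀ {P : Set} (p : Dec P) → P → ind p ≡ 1
ind-yes (yes _) _  = refl
ind-yes (no ¬p) p  = contradiction p ¬p

ind-no : ∀ {P : Set} (p : Dec P) → ¬ P → ind p ≡ 0
ind-no (yes p) ¬p = contradiction p ¬p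
ind-no (no _)  _  = refl

module _ {A : Set} where

  ∑ : List A → (A → ℕ) → ℕ
  ∑ []       f = 0
  ∑ (x ∷ xs) f = f x + ∑ xs f

  ∑-cong : ∀ xs {f g : A → ℕ} → (∀ x → f x ≡ g x) → ∑ xs f ≡ ∑ xs g
  ∑-cong []       e = refl
  ∑-cong (x ∷ xs) e = cong₂ _+_ (e x) (∑-cong xs e)

  ∑-mono : ∀ xs {f g : A → ℕ} → (∀ x → f x ≤ g x) → ∑ xs f ≤ ∑ xs g
  ∑-mono []       e = z≤n
  ∑-mono (x ∷ xs) e = +-mono-≤ (e x) (∑-mono xs e)

  ∑-zero : ∀ xs {f : A → ℕ} → (∀ x → f x ≡ 0) → ∑ xs f ≡ 0
  ∑-zero []       e = refl
  ∑-zero (x ∷ xs) e = cong₂ _+_ (e x) (∑-zero xs e)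

  ∑-+ : ∀ xs (f g : A → ℕ) → ∑ xs (λ x → f x + g x) ≡ ∑ xs f + ∑ xs g
  ∑-+ []       f g = refl
  ∑-+ (x ∷ xs) f g = trans (cong (f x + g x +_) (∑-+ xs f g)) (interchange (f x) (g x) _ _)

  ∑-*ʳ : ∀ xs (f : A → ℕ) c → ∑ xs (λ x → f x * c) ≡ ∑ xs f * c
  ∑-*ʳ []       f c = refl
  ∑-*ʳ (x ∷ xs) f c = trans (cong (f x * c +_) (∑-*ʳ xs f c)) (sym (*-distribʳ-+ c (f x) (∑ xs f)))

  ∑-++ : ∀ xs ys (f : A → ℕ) → ∑ (xs ++ ys) f ≡ ∑ xs f + ∑ ys f
  ∑-++ []       ys f = refl
  ∑-++ (x ∷ xs) ys f = trans (cong (f x +_) (∑-++ xs ys f)) (sym (+-assoc (f x) _ _))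

  ∑-witness : ∀ xs {S : Pred A 0ℓ} (S? : Decidable S) → 1 ≤ ∑ xs (λ x → ind (S? x)) → ∃ S
  ∑-witness (x ∷ xs) S? pos with S? x
  ... | yes s = x , s
  ... | no _  = ∑-witness xs S? pos

module _ {A B : Set} where

  ∑-map : ∀ (h : A → B) xs (f : B → ℕ) → ∑ (map h xs) f ≡ ∑ xs (f ∘ h)
  ∑-map h []       f = refl
  ∑-map h (x ∷ xs) f = cong (f (h x) +_) (∑-map h xs f)

  ∑-concatMap : ∀ (h : A → List B) xs (f : B → ℕ) → ∑ (concatMap h xs) f ≡ ∑ xs (λ x → ∑ (h x) f)
  ∑-concatMap h []       f = refl
  ∑-concatMap h (x ∷ xs) f = trans (∑-++ (h x) (concatMap h xs) f) (cong (∑ (h x) f +_) (∑-concatMap h xs f))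

  ∑-swap : ∀ (xs : List A) (ys : List B) (f : A → B → ℕ) →
           ∑ xs (λ a → ∑ ys (f a)) ≡ ∑ ys (λ b → ∑ xs (λ a → f a b))
  ∑-swap []       ys f = sym (∑-zero ys (λ _ → refl))
  ∑-swap (x ∷ xs) ys f =
    trans (cong (∑ ys (f x) +_) (∑-swap xs ys f)) (sym (∑-+ ys (f x) (λ b → ∑ xs (λ a → f a b))))

length-filter : ∀ {A : Set} {S : Pred A 0ℓ} (S? : Decidable S) xs →
                length (filter S? xs) ≡ ∑ xs (λ x → ind (S? x))
length-filter S? []       = refl
length-filter S? (x ∷ xs) with S? x
... | yes _ = cong suc (length-filter S? xs)
... | no _  = length-filter S? xs

Exact : ∀ {A : Set} → DecidableEquality A → List A → Set
Exact {A} _≟_ xs = ∀ (v : A) → ∑ xs (λ u → ind (u ≟ v)) ≡ 1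

module Enumeration {A : Set} (_≟_ : DecidableEquality A) (xs : List A) (exact : Exact _≟_ xs) where

  count : ∀ {S : Pred A 0ℓ} → Decidable S → ℕ
  count S? = ∑ xs (λ x → ind (S? x))

  pick : ∀ v (f : A → ℕ) → ∑ xs (λ u → ind (u ≟ v) * f u) ≡ f v
  pick v f = begin
      ∑ xs (λ u → ind (u ≟ v) * f u) ≡⟨ ∑-cong xs at-v ⟩
      ∑ xs (λ u → ind (u ≟ v) * f v) ≡⟨ ∑-*ʳ xs _ (f v) ⟩
      ∑ xs (λ u → ind (u ≟ v)) * f v ≡⟨ cong (_* f v) (exact v) ⟩
      1 * f v                        ≡⟨ *-identityˡ (f v) ⟩
      f v                            ∎
    where
    open ≡-Reasoning
    at-v : ∀ u → ind (u ≟ v) * f u ≡ ind (u ≟ v) * f v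
    at-v u with u ≟ v
    ... | yes refl = refl
    ... | no _     = refl

  reindex : (φ ψ : A → A) → (∀ a → ψ (φ a) ≡ a) → (∀ b → φ (ψ b) ≡ b) →
            (h : A → ℕ) → ∑ xs (h ∘ φ) ≡ ∑ xs h
  reindex φ ψ ψφ φψ h = begin
      ∑ xs (h ∘ φ)                                   ≡⟨ ∑-cong xs (λ a → sym (pick (φ a) h)) ⟩
      ∑ xs (λ a → ∑ xs (λ b → ind (b ≟ φ a) * h b)) ≡⟨ ∑-swap xs xs _ ⟩
      ∑ xs (λ b → ∑ xs (λ a → ind (b ≟ φ a) * h b)) ≡⟨ ∑-cong xs (λ b → ∑-cong xs (λ a → cong (_* h b) (graph a b))) ⟩
      ∑ xs (λ b → ∑ xs (λ a → ind (a ≟ ψ b) * h b)) ≡⟨ ∑-cong xs (λ b → pick (ψ b) (λ _ → h b)) ⟩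
      ∑ xs h                                         ∎
    where
    open ≡-Reasoning
    graph : ∀ a b → ind (b ≟ φ a) ≡ ind (a ≟ ψ b)
    graph a b = ind-cong (λ e → trans (sym (ψφ a)) (sym (cong ψ e)))
                         (λ e → trans (sym (φψ b)) (sym (cong φ e))) (b ≟ φ a) (a ≟ ψ b)

  module _ {S T : Pred A 0ℓ} (S? : Decidable S) (T? : Decidable T) where

    count-cong : (∀ x → S x → T x) → (∀ x → T x → S x) → count S? ≡ count T?
    count-cong f g = ∑-cong xs (λ x → ind-cong (f x) (g x) (S? x) (T? x))

    count-mono : (∀ x → S x → T x) → count S? ≤ count T?
    count-mono f = ∑-mono xs (λ x → ind-mono (f x) (S? x) (T? x))

    count-split : count S? ≡ count (S? ∩? T?) + count (S? ∩? ∁? T?)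
    count-split = trans (∑-cong xs (λ x → ind-split (S? x) (T? x))) (∑-+ xs _ _)

  count-empty : ∀ {S : Pred A 0ℓ} (S? : Decidable S) → (∀ x → ¬ S x) → count S? ≡ 0
  count-empty S? ∅ = ∑-zero xs (λ x → ind-no (S? x) (∅ x))

  count-pos : ∀ {S : Pred A 0ℓ} (S? : Decidable S) v → S v → 1 ≤ count S?
  count-pos S? v s = subst (_≤ count S?) (exact v) (∑-mono xs (λ u → ind-mono (λ { refl → s }) (u ≟ v) (S? u)))

  dec∃ : ∀ {S : Pred A 0ℓ} → Decidable S → Dec (∃ S)
  dec∃ S? with count S? in eq
  ... | zero  = no λ (v , s) → 1+n≰n (subst (1 ≤_) eq (count-pos S? v s))
  ... | suc _ = yes (∑-witness xs S? (subst (1 ≤_) (sym eq) (s≤s z≤n)))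

  dec∀ : ∀ {S : Pred A 0ℓ} → Decidable S → Dec (∀ x → S x)
  dec∀ S? with dec∃ (∁? S?)
  ... | yes (x , ¬s) = no λ all → ¬s (all x)
  ... | no ∄¬s       = yes λ x → decidable-stable (S? x) (λ ¬s → ∄¬s (x , ¬s))

  count-≡⇒⊇ : ∀ {S T : Pred A 0ℓ} (S? : Decidable S) (T? : Decidable T) → (∀ x → S x → T x) →
              count T? ≡ count S? → ∀ x → T x → S x
  count-≡⇒⊇ {S} {T} S? T? S⊆T eq x t with S? x
  ... | yes s = s
  ... | no ¬s = contradiction (subst (suc (count S?) ≤_) eq bigger) 1+n≰n
    where
    S+x≤T : ∀ u → ind (S? u) + ind (u ≟ x) ≤ ind (T? u)
    S+x≤T u with u ≟ x | S? u | T? u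
    ... | yes refl | yes s  | _      = contradiction s ¬s
    ... | yes refl | no _   | yes _  = ≤-refl
    ... | yes refl | no _   | no ¬t  = contradiction t ¬t
    ... | no _     | yes s  | yes _  = ≤-refl
    ... | no _     | yes s  | no ¬t  = contradiction (S⊆T u s) ¬t
    ... | no _     | no _   | _      = z≤n
    bigger : suc (count S?) ≤ count T?
    bigger = subst (_≤ count T?) (trans (∑-+ xs _ _) (trans (cong (count S? +_) (exact x)) (+-comm _ 1)))
                   (∑-mono xs S+x≤T)

module Partition {A : Set} (_≟_ : DecidableEquality A) (xs : List A) (exact : Exact _≟_ xs)
                 {R : A → A → Set} (R? : ∀ a b → Dec (R a b)) (R-equiv : IsEquivalence R)
                 {F : Pred A 0ℓ} (F? : Decidable F) (F-resp : F Respects R) (d : ℕ) where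

  open Enumeration _≟_ xs exact
  open IsEquivalence R-equiv renaming (refl to R-refl; sym to R-sym; trans to R-trans)

  OuterClassesDivisible : ∀ {X : Pred A 0ℓ} → Decidable X → Set
  OuterClassesDivisible {X} X? = ∀ a → X a → ¬ F a → d ∣ count (X? ∩? R? a)

  classContribution : ∀ {X : Pred A 0ℓ} (X? : Decidable X) → OuterClassesDivisible X? →
    ∀ x → X x → ∃ λ c → count (X? ∩? R? x) ≡ count ((X? ∩? R? x) ∩? F?) + c * d
  classContribution X? div x x∈X with F? x
  ... | yes Fx = 0 , trans (count-cong _ _ (λ b (b∈X , xRb) → (b∈X , xRb) , F-resp xRb Fx) (λ _ → proj₁))
                           (sym (+-identityʳ _))
  ... | no ¬Fx with div x x∈X ¬Fx
  ...   | divides c eq = c , trans eq (sym (cong (_+ c * d)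
                                  (count-empty _ (λ b ((_ , xRb) , Fb) → ¬Fx (F-resp (R-sym xRb) Fb)))))

  module RemoveClass {X : Pred A 0ℓ} (X? : Decidable X) (x : A) where

    C? : Decidable (X ∩ R x)
    C? = X? ∩? R? x

    X'? : Decidable (X ∩ ∁ (R x))
    X'? = X? ∩? ∁? (R? x)

    split : count X? ≡ count C? + count X'?
    split = count-split X? (R? x)

    splitF : count (X? ∩? F?) ≡ count (C? ∩? F?) + count (X'? ∩? F?)
    splitF = trans (count-split (X? ∩? F?) (R? x)) (cong₂ _+_ (count-cong _ _ swap swap) (count-cong _ _ swap swap))
      where
      swap : ∀ {P Q S : Pred A 0ℓ} y → ((P ∩ Q) ∩ S) y → ((P ∩ S) ∩ Q) y
      swap _ ((p , q) , s) = (p , s) , q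

    smaller : X x → suc (count X'?) ≤ count X?
    smaller x∈X = subst (suc (count X'?) ≤_) (sym split) (+-monoˡ-≤ (count X'?) (count-pos C? x (x∈X , R-refl)))

    remaining : OuterClassesDivisible X? → OuterClassesDivisible X'?
    remaining div a (a∈X , ¬xRa) ¬Fa = subst (d ∣_)
      (count-cong (X? ∩? R? a) _ (λ b (b∈X , aRb) → (b∈X , λ xRb → ¬xRa (R-trans xRb (R-sym aRb))) , aRb)
                                 (λ b ((b∈X , _) , aRb) → b∈X , aRb))
      (div a a∈X ¬Fa)

    combine : ∀ c m → count C? ≡ count (C? ∩? F?) + c * d → count X'? ≡ count (X'? ∩? F?) + m * d →
              count X? ≡ count (X? ∩? F?) + (c + m) * d
    combine c m classEq restEq = begin
      count X?                                                  ≡⟨ split ⟩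
      count C? + count X'?                                      ≡⟨ cong₂ _+_ classEq restEq ⟩
      (count (C? ∩? F?) + c * d) + (count (X'? ∩? F?) + m * d)  ≡⟨ regroup (count (C? ∩? F?)) c (count (X'? ∩? F?)) m d ⟩
      (count (C? ∩? F?) + count (X'? ∩? F?)) + (c + m) * d      ≡⟨ cong (_+ (c + m) * d) (sym splitF) ⟩
      count (X? ∩? F?) + (c + m) * d                            ∎
      where
      open ≡-Reasoning
      regroup : ∀ u c v m d → (u + c * d) + (v + m * d) ≡ (u + v) + (c + m) * d
      regroup = solve 5 (λ u c v m d → (u :+ c :* d) :+ (v :+ m :* d) := (u :+ v) :+ (c :+ m) :* d) refl
        where open +-*-Solver

  partitionCount : ∀ {X : Pred A 0ℓ} (X? : Decidable X) → OuterClassesDivisible X? →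
                   ∃ λ m → count X? ≡ count (X? ∩? F?) + m * d
  partitionCount X? = go (count X?) X? ≤-refl
    where
    go : ∀ k {X : Pred A 0ℓ} (X? : Decidable X) → count X? ≤ k → OuterClassesDivisible X? →
         ∃ λ m → count X? ≡ count (X? ∩? F?) + m * d
    go k X? bound div with dec∃ X?
    go k X? bound div | no ∄x =
      0 , trans (count-empty X? (λ x x∈X → ∄x (x , x∈X)))
                (sym (cong (_+ 0) (count-empty _ (λ x (x∈X , _) → ∄x (x , x∈X)))))
    go zero X? bound div | yes (x , x∈X) = contradiction (≤-trans (count-pos X? x x∈X) bound) λ ()
    go (suc k) X? bound div | yes (x , x∈X)
      with classContribution X? div x x∈X
         | go k X'? (≤-pred (≤-trans (smaller x∈X) bound)) (remaining div)
      where open RemoveClass X? x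
    ... | c , classEq | m , restEq = c + m , combine c m classEq restEq
      where open RemoveClass X? x

allFin-exact : ∀ n → Exact _≟ᶠ_ (allFin n)
allFin-exact (suc n) v = begin
    ∑ (allFin (suc n)) (λ u → ind (u ≟ᶠ v))
      ≡⟨ cong (λ l → ∑ (zero ∷ l) (λ u → ind (u ≟ᶠ v))) (sym (Listₚ.map-tabulate (λ i → i) suc)) ⟩
    ind (zero ≟ᶠ v) + ∑ (map suc (allFin n)) (λ u → ind (u ≟ᶠ v))
      ≡⟨ cong (ind (zero ≟ᶠ v) +_) (∑-map suc (allFin n) _) ⟩
    ind (zero ≟ᶠ v) + ∑ (allFin n) (λ u → ind (suc u ≟ᶠ v))
      ≡⟨ at v ⟩
    1 ∎
  where
  open ≡-Reasoning
  at : ∀ v → ind (zero ≟ᶠ v) + ∑ (allFin n) (λ u → ind (suc u ≟ᶠ v)) ≡ 1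
  at zero    = cong suc (∑-zero (allFin n) (λ u → ind-no (suc u ≟ᶠ zero) λ ()))
  at (suc w) = trans (∑-cong (allFin n) (λ u → ind-cong Finₚ.suc-injective (cong suc) (suc u ≟ᶠ suc w) (u ≟ᶠ w)))
                     (allFin-exact n w)

vecs-exact : ∀ {A : Set} (_≟_ : DecidableEquality A) (xs : List A) → Exact _≟_ xs →
             ∀ k → Exact (Vecₚ.≡-dec _≟_) (vecs xs k)
vecs-exact _≟_ xs exact zero    []      = refl
vecs-exact _≟_ xs exact (suc k) (y ∷ v) = begin
    ∑ (concatMap (λ x → map (x ∷_) (vecs xs k)) xs) (λ u → ind (u ≟ⱽ (y ∷ v)))
      ≡⟨ ∑-concatMap _ xs _ ⟩
    ∑ xs (λ x → ∑ (map (x ∷_) (vecs xs k)) (λ u → ind (u ≟ⱽ (y ∷ v))))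
      ≡⟨ ∑-cong xs (λ x → ∑-map (x ∷_) (vecs xs k) _) ⟩
    ∑ xs (λ x → ∑ (vecs xs k) (λ w → ind ((x ∷ w) ≟ⱽ (y ∷ v))))
      ≡⟨ ∑-cong xs (λ x → ∑-cong (vecs xs k) (λ w → cons-ind x w)) ⟩
    ∑ xs (λ x → ∑ (vecs xs k) (λ w → ind (w ≟ⱽ v) * ind (x ≟ y)))
      ≡⟨ ∑-cong xs (λ x → ∑-*ʳ (vecs xs k) _ (ind (x ≟ y))) ⟩
    ∑ xs (λ x → ∑ (vecs xs k) (λ w → ind (w ≟ⱽ v)) * ind (x ≟ y))
      ≡⟨ ∑-cong xs (λ x → trans (cong (_* ind (x ≟ y)) (vecs-exact _≟_ xs exact k v)) (*-identityˡ _)) ⟩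
    ∑ xs (λ x → ind (x ≟ y))
      ≡⟨ exact y ⟩
    1 ∎
  where
  open ≡-Reasoning
  _≟ⱽ_ : ∀ {m} → DecidableEquality (Vec _ m)
  _≟ⱽ_ = Vecₚ.≡-dec _≟_
  cons-ind : ∀ x w → ind ((x ∷ w) ≟ⱽ (y ∷ v)) ≡ ind (w ≟ⱽ v) * ind (x ≟ y)
  cons-ind x w = trans (ind-cong (λ e → let (x≡y , w≡v) = Vecₚ.∷-injective e in w≡v , x≡y)
                                 (λ (w≡v , x≡y) → cong₂ _∷_ x≡y w≡v) ((x ∷ w) ≟ⱽ (y ∷ v)) ((w ≟ⱽ v) ×-dec (x ≟ y)))
                       (ind-× (w ≟ⱽ v) (x ≟ y))

_≟ₚ_ : ∀ {n} → DecidableEquality (Perm n)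
_≟ₚ_ = Vecₚ.≡-dec _≟ᶠ_

allMaps-exact : ∀ n → Exact _≟ₚ_ (allMaps n)
allMaps-exact n = vecs-exact _≟ᶠ_ (allFin n) (allFin-exact n) n

module Perms (n : ℕ) = Enumeration (_≟ₚ_ {n}) (allMaps n) (allMaps-exact n)

order≡count : ∀ {n} {S : PSet n} (S? : Decidable S) → order S? ≡ Perms.count n S?
order≡count {n} S? = length-filter S? (allMaps n)

module _ {n : ℕ} where

  lookup-∘ : ∀ (σ τ : Perm n) i → lookup (σ ∘ₚ τ) i ≡ lookup σ (lookup τ i)
  lookup-∘ σ τ = Vecₚ.lookup∘tabulate _

  lookup-id : ∀ i → lookup (idₚ {n}) i ≡ i
  lookup-id = Vecₚ.lookup∘tabulate _

  ≗⇒≡ : ∀ {σ τ : Perm n} → (∀ i → lookup σ i ≡ lookup τ i) → σ ≡ τ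
  ≗⇒≡ {σ} {τ} e = trans (sym (Vecₚ.tabulate∘lookup σ)) (trans (Vecₚ.tabulate-cong e) (Vecₚ.tabulate∘lookup τ))

  ∘-assoc : ∀ (a b c : Perm n) → (a ∘ₚ b) ∘ₚ c ≡ a ∘ₚ (b ∘ₚ c)
  ∘-assoc a b c = ≗⇒≡ λ i → begin
      lookup ((a ∘ₚ b) ∘ₚ c) i      ≡⟨ lookup-∘ (a ∘ₚ b) c i ⟩
      lookup (a ∘ₚ b) (lookup c i)  ≡⟨ lookup-∘ a b _ ⟩
      lookup a (lookup b (lookup c i)) ≡⟨ cong (lookup a) (lookup-∘ b c i) ⟨
      lookup a (lookup (b ∘ₚ c) i)  ≡⟨ lookup-∘ a (b ∘ₚ c) i ⟨
      lookup (a ∘ₚ (b ∘ₚ c)) i      ∎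
    where open ≡-Reasoning

  ∘-identityˡ : ∀ (a : Perm n) → idₚ ∘ₚ a ≡ a
  ∘-identityˡ a = ≗⇒≡ λ i → trans (lookup-∘ idₚ a i) (lookup-id _)

  ∘-identityʳ : ∀ (a : Perm n) → a ∘ₚ idₚ ≡ a
  ∘-identityʳ a = ≗⇒≡ λ i → trans (lookup-∘ a idₚ i) (cong (lookup a) (lookup-id i))

Fixes : ∀ {n} → Fin n → PSet n
Fixes α σ = lookup σ α ≡ α

Fixes? : ∀ {n} (α : Fin n) → Decidable (Fixes α)
Fixes? α σ = lookup σ α ≟ᶠ α

∘-monoid : ℕ → Monoid 0ℓ 0ℓ
∘-monoid n = record
  { Carrier = Perm n ; _≈_ = _≡_ ; _∙_ = _∘ₚ_ ; ε = idₚ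
  ; isMonoid = record
    { isSemigroup = record
      { isMagma = record { isEquivalence = isEquivalence ; ∙-cong = cong₂ _∘ₚ_ }
      ; assoc = ∘-assoc }
    ; identity = ∘-identityˡ , ∘-identityʳ } }

module _ {n : ℕ} where
  open import Algebra.Solver.Monoid (∘-monoid n) using (solve; _⊜_; _⊕_)

  cancelˡ : ∀ (a a' b : Perm n) → a' ∘ₚ a ≡ idₚ → a' ∘ₚ (a ∘ₚ b) ≡ b
  cancelˡ a a' b e = trans (sym (∘-assoc a' a b)) (trans (cong (_∘ₚ b) e) (∘-identityˡ b))

  cancelʳ : ∀ (a a' b : Perm n) → a ∘ₚ a' ≡ idₚ → (b ∘ₚ a) ∘ₚ a' ≡ b
  cancelʳ a a' b e = trans (∘-assoc b a a') (trans (cong (b ∘ₚ_) e) (∘-identityʳ b))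

  conj-flip : ∀ (k k' u v : Perm n) → k' ∘ₚ k ≡ idₚ → k ∘ₚ k' ≡ idₚ →
              k ∘ₚ u ≡ v ∘ₚ k → k' ∘ₚ v ≡ u ∘ₚ k'
  conj-flip k k' u v k'k kk' e = begin
      k' ∘ₚ v                 ≡⟨ cancelʳ k k' (k' ∘ₚ v) kk' ⟨
      ((k' ∘ₚ v) ∘ₚ k) ∘ₚ k'  ≡⟨ cong (_∘ₚ k') (∘-assoc k' v k) ⟩
      (k' ∘ₚ (v ∘ₚ k)) ∘ₚ k'  ≡⟨ cong (λ t → (k' ∘ₚ t) ∘ₚ k') e ⟨
      (k' ∘ₚ (k ∘ₚ u)) ∘ₚ k'  ≡⟨ cong (_∘ₚ k') (cancelˡ k k' u k'k) ⟩
      u ∘ₚ k'                 ∎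
    where open ≡-Reasoning

  regroup : ∀ (a b c d e : Perm n) → a ∘ₚ ((b ∘ₚ (c ∘ₚ d)) ∘ₚ e) ≡ (a ∘ₚ b) ∘ₚ (c ∘ₚ (d ∘ₚ e))
  regroup = solve 5 (λ a b c d e → a ⊕ ((b ⊕ (c ⊕ d)) ⊕ e) ⊜ (a ⊕ b) ⊕ (c ⊕ (d ⊕ e))) refl

  unconjugate : ∀ (a a' c b b' : Perm n) → a' ∘ₚ a ≡ idₚ → b ∘ₚ b' ≡ idₚ → a' ∘ₚ ((a ∘ₚ (c ∘ₚ b)) ∘ₚ b') ≡ c
  unconjugate a a' c b b' a'a bb' = begin
      a' ∘ₚ ((a ∘ₚ (c ∘ₚ b)) ∘ₚ b') ≡⟨ regroup a' a c b b' ⟩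
      (a' ∘ₚ a) ∘ₚ (c ∘ₚ (b ∘ₚ b'))  ≡⟨ cong₂ (λ u w → u ∘ₚ (c ∘ₚ w)) a'a bb' ⟩
      idₚ ∘ₚ (c ∘ₚ idₚ)             ≡⟨ trans (∘-identityˡ _) (∘-identityʳ c) ⟩
      c                             ∎
    where open ≡-Reasoning

module Inverses {n : ℕ} {K S : PSet n} (S-sub : IsSubgroupOf K S) where
  open IsSubgroupOf S-sub

  inverse : ∀ x → S x → Perm n
  inverse x sx = proj₁ (inv∈ x sx)

  inverse-∈ : ∀ x sx → S (inverse x sx)
  inverse-∈ x sx = proj₁ (proj₂ (inv∈ x sx))

  inverseʳ : ∀ x sx → x ∘ₚ inverse x sx ≡ idₚ
  inverseʳ x sx = proj₁ (proj₂ (proj₂ (inv∈ x sx)))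

  inverseˡ : ∀ x sx → inverse x sx ∘ₚ x ≡ idₚ
  inverseˡ x sx = proj₂ (proj₂ (proj₂ (inv∈ x sx)))

∤-of-congruent : ∀ {d u v} m → u ≡ v + m * d → ¬ d ∣ v → ¬ d ∣ u
∤-of-congruent {d} m u≡v+md d∤v d∣u =
  d∤v (∣m+n∣m⇒∣n (subst (d ∣_) (trans u≡v+md (+-comm _ (m * d))) d∣u) (n∣m*n m))

module _ {p : ℕ} (p-prime : Prime p) where
  private instance
    p≢0 : NonZero p
    p≢0 = prime⇒nonZero p-prime

  divisor-of-prime-power : ∀ k m s → m * s ≡ p ^ k → ∃ λ j → s ≡ p ^ j
  divisor-of-prime-power zero    m s e = 0 , m*n≡1⇒n≡1 m s e
  divisor-of-prime-power (suc k) m s e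
    with euclidsLemma m s p-prime (divides (p ^ k) (trans e (*-comm p (p ^ k))))
  ... | inj₁ (divides m' refl) =
    divisor-of-prime-power k m' s (*-cancelˡ-≡ (m' * s) (p ^ k) p (trans shift e))
    where
    shift : p * (m' * s) ≡ m' * p * s
    shift = trans (sym (*-assoc p m' s)) (cong (_* s) (*-comm p m'))
  ... | inj₂ (divides s' refl) =
    let (j , s'≡p^j) = divisor-of-prime-power k m s' (*-cancelˡ-≡ (m * s') (p ^ k) p (trans shift e))
    in suc j , trans (cong (_* p) s'≡p^j) (*-comm (p ^ j) p)
    where
    shift : p * (m * s') ≡ m * (s' * p)
    shift = trans (*-comm p (m * s')) (*-assoc m s' p)

  cofactor-divisible : ∀ a m s → m * s ≡ p ^ a * p ^ a → s ≤ p ^ a → s ≢ p ^ a → p ^ suc a ∣ m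
  cofactor-divisible a m s e s≤ s≢ with divisor-of-prime-power (a + a) m s (trans e (sym (^-distribˡ-+-* p a a)))
  ... | j , s≡p^j with j <? a
  ...   | no j≮a = contradiction (≤-antisym s≤ (subst (p ^ a ≤_) (sym s≡p^j) (^-monoʳ-≤ p (≮⇒≥ j≮a)))) s≢
  ...   | yes j<a with m≤n⇒∃[o]m+o≡n j<a
  ...     | t , refl = divides (p ^ t) (*-cancelʳ-≡ m _ (p ^ j) {{m^n≢0 p j}} (begin
      m * p ^ j                           ≡⟨ cong (m *_) s≡p^j ⟨
      m * s                               ≡⟨ e ⟩
      p ^ x * p ^ x                       ≡⟨ ^-distribˡ-+-* p x x ⟨
      p ^ (x + x)                         ≡⟨ cong (p ^_) exponents ⟩
      p ^ (t + suc x + j)                 ≡⟨ ^-distribˡ-+-* p (t + suc x) j ⟩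
      p ^ (t + suc x) * p ^ j             ≡⟨ cong (_* p ^ j) (^-distribˡ-+-* p t (suc x)) ⟩
      p ^ t * p ^ suc x * p ^ j           ∎))
    where
    open ≡-Reasoning
    x : ℕ
    x = suc j + t
    exponents : x + x ≡ t + suc x + j
    exponents = solve 2 (λ j t → (con 1 :+ j :+ t) :+ (con 1 :+ j :+ t) := (t :+ (con 1 :+ (con 1 :+ j :+ t))) :+ j) refl j t
      where open +-*-Solver

module DoubleCosets {n : ℕ} {K P : PSet n} (P? : Decidable P) (P-sub : IsSubgroupOf K P) where
  open IsSubgroupOf P-sub
  open Inverses P-sub
  open Perms n

  allPerms : List (Perm n)
  allPerms = allMaps n

  ConjInto : Perm n → Set
  ConjInto k = ∀ x → P x → ∃ λ y → P y × k ∘ₚ x ≡ y ∘ₚ k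

  ConjOnto : Perm n → Set
  ConjOnto k = ∀ y → P y → ∃ λ x → P x × k ∘ₚ x ≡ y ∘ₚ k

  module _ (k k' : Perm n) (kk' : k ∘ₚ k' ≡ idₚ) (k'k : k' ∘ₚ k ≡ idₚ) where

    onto⇒into⁻¹ : ConjOnto k → ConjInto k'
    onto⇒into⁻¹ onto y py = let (x , px , e) = onto y py in x , px , conj-flip k k' x y k'k kk' e

    Conjugate : Pred (Perm n) 0ℓ
    Conjugate w = ∃ λ x → P x × w ≡ k ∘ₚ (x ∘ₚ k')

    Conjugate? : Decidable Conjugate
    Conjugate? w = dec∃ (λ x → P? x ×-dec (w ≟ₚ (k ∘ₚ (x ∘ₚ k'))))

    -- Conjugation is a bijection, so |kPk⁻¹| = |P|.
    conjugate-size : count Conjugate? ≡ count P?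
    conjugate-size = trans (sym (reindex conj unconj unconj∘conj conj∘unconj (λ w → ind (Conjugate? w))))
                           (count-cong (Conjugate? ∘ conj) P? conj-inj (λ z pz → z , pz , refl))
      where
      conj unconj : Perm n → Perm n
      conj z = k ∘ₚ (z ∘ₚ k')
      unconj w = k' ∘ₚ (w ∘ₚ k)
      unconj∘conj : ∀ z → unconj (conj z) ≡ z
      unconj∘conj z = unconjugate k k' z k' k k'k k'k
      conj∘unconj : ∀ w → conj (unconj w) ≡ w
      conj∘unconj w = unconjugate k' k w k k' kk' kk'
      conj-inj : ∀ z → Conjugate (conj z) → P z
      conj-inj z (x , px , e) = subst P (trans (sym (unconj∘conj x)) (trans (cong unconj (sym e)) (unconj∘conj z))) px

    -- For finite P, kPk⁻¹ ⊆ P already forces kPk⁻¹ = P.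
    into⇒onto : ConjInto k → ConjOnto k
    into⇒onto into y py =
      let (x , px , y≡kxk') = count-≡⇒⊇ Conjugate? P? conj⊆P (sym conjugate-size) y py
      in x , px , sym (trans (cong (_∘ₚ k) y≡kxk') (trans (∘-assoc k (x ∘ₚ k') k) (cong (k ∘ₚ_) (cancelʳ k' k x k'k))))
      where
      conj⊆P : ∀ w → Conjugate w → P w
      conj⊆P w (x , px , refl) = let (y , py , kx≡yk) = into x px in
        subst P (sym (trans (sym (∘-assoc k x k')) (trans (cong (_∘ₚ k') kx≡yk) (cancelʳ k k' y kk')))) py

  LeftFactor : Perm n → Perm n → Pred (Perm n) 0ℓ
  LeftFactor g z x = P x × ∃ λ y → P y × z ≡ x ∘ₚ (g ∘ₚ y)

  LeftFactor? : ∀ g z → Decidable (LeftFactor g z)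
  LeftFactor? g z x = P? x ×-dec dec∃ (λ y → P? y ×-dec (z ≟ₚ (x ∘ₚ (g ∘ₚ y))))

  DoubleCoset : Perm n → Perm n → Set
  DoubleCoset g z = ∃ (LeftFactor g z)

  DoubleCoset? : ∀ g → Decidable (DoubleCoset g)
  DoubleCoset? g z = dec∃ (LeftFactor? g z)

  doubleCoset-equivalence : IsEquivalence DoubleCoset
  doubleCoset-equivalence = record
    { refl  = λ {g} → idₚ , id∈ , idₚ , id∈ , sym (trans (∘-identityˡ _) (∘-identityʳ g))
    ; sym   = λ { {g} (x , px , y , py , refl) →
                inverse x px , inverse-∈ x px , inverse y py , inverse-∈ y py ,
                sym (unconjugate x (inverse x px) g y (inverse y py) (inverseˡ x px) (inverseʳ y py)) }
    ; trans = λ { {g} (x₁ , px₁ , y₁ , py₁ , refl) (x₂ , px₂ , y₂ , py₂ , refl) →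
                x₂ ∘ₚ x₁ , ∘∈ x₂ x₁ px₂ px₁ , y₁ ∘ₚ y₂ , ∘∈ y₁ y₂ py₁ py₂ , regroup x₂ x₁ g y₁ y₂ } }

  fixers-resp : ∀ α → (∀ x → P x → Fixes α x) → Fixes α Respects DoubleCoset
  fixers-resp α P-fixes {g} (x , px , y , py , refl) gα≡α = begin
    lookup (x ∘ₚ (g ∘ₚ y)) α        ≡⟨ lookup-∘ x (g ∘ₚ y) α ⟩
    lookup x (lookup (g ∘ₚ y) α)    ≡⟨ cong (lookup x) (lookup-∘ g y α) ⟩
    lookup x (lookup g (lookup y α)) ≡⟨ cong (lookup x) (cong (lookup g) (P-fixes y py)) ⟩
    lookup x (lookup g α)           ≡⟨ cong (lookup x) gα≡α ⟩
    lookup x α                      ≡⟨ P-fixes x px ⟩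
    α                               ∎
    where open ≡-Reasoning

  -- |P ∩ gPg⁻¹|, counted as the number of left factors of g itself.
  intersectionSize : Perm n → ℕ
  intersectionSize g = count (LeftFactor? g g)

  intersectionSize≤ : ∀ g → intersectionSize g ≤ count P?
  intersectionSize≤ g = count-mono (LeftFactor? g g) P? (λ _ → proj₁)

  -- Every element of PgP has as many left factors as g: multiply by x₀⁻¹ where z = x₀gy₀.
  leftFactors-of : ∀ g z → DoubleCoset g z → count (LeftFactor? g z) ≡ intersectionSize g
  leftFactors-of g z (x₀ , px₀ , y₀ , py₀ , z≡x₀gy₀) =
    trans (count-cong (LeftFactor? g z) (LeftFactor? g g ∘ shift) forth back)
          (reindex shift unshift (λ a → cancelˡ x₀' x₀ a (inverseʳ x₀ px₀))
                                 (λ b → cancelˡ x₀ x₀' b (inverseˡ x₀ px₀)) (λ x → ind (LeftFactor? g g x)))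
    where
    x₀' y₀' : Perm n
    x₀' = inverse x₀ px₀
    y₀' = inverse y₀ py₀
    shift unshift : Perm n → Perm n
    shift a = x₀' ∘ₚ a
    unshift b = x₀ ∘ₚ b
    forth : ∀ a → LeftFactor g z a → LeftFactor g g (shift a)
    forth a (pa , y , py , z≡agy) = ∘∈ x₀' a (inverse-∈ x₀ px₀) pa , y ∘ₚ y₀' , ∘∈ y y₀' py (inverse-∈ y₀ py₀) , (begin
      g                                   ≡⟨ unconjugate x₀ x₀' g y₀ y₀' (inverseˡ x₀ px₀) (inverseʳ y₀ py₀) ⟨
      x₀' ∘ₚ ((x₀ ∘ₚ (g ∘ₚ y₀)) ∘ₚ y₀')   ≡⟨ cong (λ t → x₀' ∘ₚ (t ∘ₚ y₀')) (trans (sym z≡x₀gy₀) z≡agy) ⟩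
      x₀' ∘ₚ ((a ∘ₚ (g ∘ₚ y)) ∘ₚ y₀')     ≡⟨ regroup x₀' a g y y₀' ⟩
      (x₀' ∘ₚ a) ∘ₚ (g ∘ₚ (y ∘ₚ y₀'))     ∎)
      where open ≡-Reasoning
    back : ∀ a → LeftFactor g g (shift a) → LeftFactor g z a
    back a (pa' , y , py , g≡a'gy) =
      subst P (cancelˡ x₀' x₀ a (inverseʳ x₀ px₀)) (∘∈ x₀ (shift a) px₀ pa') , y ∘ₚ y₀ , ∘∈ y y₀ py py₀ , (begin
      z                                             ≡⟨ z≡x₀gy₀ ⟩
      x₀ ∘ₚ (g ∘ₚ y₀)                               ≡⟨ cong (λ t → x₀ ∘ₚ (t ∘ₚ y₀)) g≡a'gy ⟩
      x₀ ∘ₚ (((x₀' ∘ₚ a) ∘ₚ (g ∘ₚ y)) ∘ₚ y₀)        ≡⟨ regroup x₀ (x₀' ∘ₚ a) g y y₀ ⟩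
      (x₀ ∘ₚ (x₀' ∘ₚ a)) ∘ₚ (g ∘ₚ (y ∘ₚ y₀))        ≡⟨ cong (_∘ₚ (g ∘ₚ (y ∘ₚ y₀))) (cancelˡ x₀' x₀ a (inverseʳ x₀ px₀)) ⟩
      a ∘ₚ (g ∘ₚ (y ∘ₚ y₀))                         ∎)
      where open ≡-Reasoning

  leftFactors : ∀ g z → count (LeftFactor? g z) ≡ ind (DoubleCoset? g z) * intersectionSize g
  leftFactors g z with DoubleCoset? g z
  ... | yes z∈PgP = trans (leftFactors-of g z z∈PgP) (sym (+-identityʳ _))
  ... | no  z∉PgP = count-empty (LeftFactor? g z) (λ x lf → z∉PgP (x , lf))

  module _ (g g' : Perm n) (gg' : g ∘ₚ g' ≡ idₚ) (g'g : g' ∘ₚ g ≡ idₚ) where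

    leftFactor-column : ∀ x → ∑ allPerms (λ z → ind (LeftFactor? g z x)) ≡ ind (P? x) * count P?
    leftFactor-column x = column (P? x)
      where
      column : Dec (P x) → ∑ allPerms (λ z → ind (LeftFactor? g z x)) ≡ ind (P? x) * count P?
      column (no ¬px) = trans (∑-zero allPerms (λ z → ind-no (LeftFactor? g z x) (¬px ∘ proj₁)))
                              (sym (cong (_* count P?) (ind-no (P? x) ¬px)))
      column (yes px) = trans (sym (reindex xg· ·xg unxg∘xg xg∘unxg (λ z → ind (LeftFactor? g z x))))
                        (trans (count-cong (λ y → LeftFactor? g (xg· y) x) P? cancel (λ y py → px , y , py , refl))
                        (trans (sym (+-identityʳ _)) (sym (cong (_* count P?) (ind-yes (P? x) px)))))
        where
        x' : Perm n
        x' = inverse x px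
        xg· ·xg : Perm n → Perm n
        xg· y = x ∘ₚ (g ∘ₚ y)
        ·xg z = g' ∘ₚ (x' ∘ₚ z)
        unxg∘xg : ∀ y → ·xg (xg· y) ≡ y
        unxg∘xg y = trans (cong (g' ∘ₚ_) (cancelˡ x x' (g ∘ₚ y) (inverseˡ x px))) (cancelˡ g g' y g'g)
        xg∘unxg : ∀ z → xg· (·xg z) ≡ z
        xg∘unxg z = trans (cong (x ∘ₚ_) (cancelˡ g' g (x' ∘ₚ z) gg')) (cancelˡ x' x z (inverseʳ x px))
        cancel : ∀ y → LeftFactor g (xg· y) x → P y
        cancel y (_ , y' , py' , e) = subst P (trans (sym (unxg∘xg y')) (trans (cong ·xg (sym e)) (unxg∘xg y))) py'

    -- |PgP| · |P ∩ gPg⁻¹| = |P|², by counting the pairs (z, x) with x a left factor of z.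
    doubleCoset-size : count (DoubleCoset? g) * intersectionSize g ≡ count P? * count P?
    doubleCoset-size = begin
      count (DoubleCoset? g) * intersectionSize g                   ≡⟨ ∑-*ʳ allPerms _ (intersectionSize g) ⟨
      ∑ allPerms (λ z → ind (DoubleCoset? g z) * intersectionSize g) ≡⟨ ∑-cong allPerms (leftFactors g) ⟨
      ∑ allPerms (λ z → ∑ allPerms (λ x → ind (LeftFactor? g z x))) ≡⟨ ∑-swap allPerms allPerms _ ⟩
      ∑ allPerms (λ x → ∑ allPerms (λ z → ind (LeftFactor? g z x))) ≡⟨ ∑-cong allPerms leftFactor-column ⟩
      ∑ allPerms (λ x → ind (P? x) * count P?)                      ≡⟨ ∑-*ʳ allPerms _ (count P?) ⟩
      count P? * count P?                                           ∎
      where open ≡-Reasoning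

    full-intersection⇒normalises : intersectionSize g ≡ count P? → ConjInto g
    full-intersection⇒normalises full =
      onto⇒into⁻¹ g' g g'g gg' (into⇒onto g' g g'g gg' (onto⇒into⁻¹ g g' gg' g'g onto))
      where
      all-factors : ∀ x → P x → LeftFactor g g x
      all-factors = count-≡⇒⊇ (LeftFactor? g g) P? (λ _ → proj₁) (sym full)
      onto : ConjOnto g
      onto y py = let (_ , w , pw , g≡y'gw) = all-factors (inverse y py) (inverse-∈ y py) in
        w , pw , sym (trans (cong (y ∘ₚ_) g≡y'gw) (cancelˡ (inverse y py) y (g ∘ₚ w) (inverseʳ y py)))

⟦_⟧ : ∀ {n} {Q : Pred (Fin n) 0ℓ} → Decidable Q → Subset n
⟦ Q? ⟧ = tabulate (does ∘ Q?)

∈⟦_⟧ : ∀ {n} {Q : Pred (Fin n) 0ℓ} (Q? : Decidable Q) {i} → Q i → i ∈ ⟦ Q? ⟧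
∈⟦ Q? ⟧ {i} q = Vecₚ.lookup⇒[]= i _ (trans (Vecₚ.lookup∘tabulate _ i) (dec-true (Q? i) q))

∈⟦_⟧⁻¹ : ∀ {n} {Q : Pred (Fin n) 0ℓ} (Q? : Decidable Q) {i} → i ∈ ⟦ Q? ⟧ → Q i
∈⟦ Q? ⟧⁻¹ {i} i∈ with Q? i | trans (sym (Vecₚ.[]=⇒lookup i∈)) (Vecₚ.lookup∘tabulate _ i)
... | yes q | _  = q
... | no _  | ()

atMostOne : ∀ {n} {B : Subset n} {i j : Fin n} → ∣ B ∣ ≤ 1 → i ∈ B → j ∈ B → i ≡ j
atMostOne {B = B} {i} {j} small i∈B j∈B with i ≟ᶠ j
... | yes i≡j = i≡j
... | no  i≢j = contradiction (≤-trans (subst (λ t → t < ∣ B ∣) (∣⁅x⁆∣≡1 i) (p⊂q⇒∣p∣<∣q∣ (⁅i⁆⊆B , j , j∈B , j∉⁅i⁆))) small) 1+n≰n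
  where
  ⁅i⁆⊆B : ∀ {x} → x ∈ ⁅ i ⁆ → x ∈ B
  ⁅i⁆⊆B x∈ = subst (_∈ B) (sym (x∈⁅y⁆⇒x≡y i x∈)) i∈B
  j∉⁅i⁆ : j ∉ ⁅ i ⁆
  j∉⁅i⁆ = x≢y⇒x∉⁅y⁆ (i≢j ∘ sym)

-- For a subgroup K with G_α ≤ K ≤ G, the orbit Kα is a block of G; so in a
-- primitive group K either fixes α or is transitive.
module OvergroupOfStabiliser {n : ℕ} {G K : PSet n} (G-grp : IsPermGroup G) (K-sub : IsSubgroupOf G K)
                             (K? : Decidable K) (α : Fin n) (Gα⊆K : ∀ h → Stab G α h → K h) where
  open Perms n
  open IsSubgroupOf K-sub
  open Inverses K-sub
  module G = IsSubgroupOf G-grp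

  Orbit : Pred (Fin n) 0ℓ
  Orbit γ = ∃ λ k → K k × lookup k α ≡ γ

  Orbit? : Decidable Orbit
  Orbit? γ = dec∃ (λ k → K? k ×-dec (lookup k α ≟ᶠ γ))

  orbit : Subset n
  orbit = ⟦ Orbit? ⟧

  -- If g ∈ G maps a point k₁α of the orbit to a point k₂α of it, then
  -- k₂⁻¹gk₁ ∈ G_α ≤ K, hence g ∈ K.
  meets⇒∈K : ∀ g k₁ k₂ → G g → K k₁ → K k₂ → lookup g (lookup k₁ α) ≡ lookup k₂ α → K g
  meets⇒∈K g k₁ k₂ gg kk₁ kk₂ e = subst K g≡k₂hk₁' (∘∈ k₂ (h ∘ₚ k₁') kk₂ (∘∈ h k₁' (Gα⊆K h (gh , h-fixes)) (inverse-∈ k₁ kk₁)))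
    where
    k₁' k₂' h : Perm n
    k₁' = inverse k₁ kk₁
    k₂' = inverse k₂ kk₂
    h = k₂' ∘ₚ (g ∘ₚ k₁)
    gh : G h
    gh = G.∘∈ k₂' (g ∘ₚ k₁) (⊆K k₂' (inverse-∈ k₂ kk₂)) (G.∘∈ g k₁ gg (⊆K k₁ kk₁))
    h-fixes : Fixes α h
    h-fixes = begin
      lookup h α                         ≡⟨ lookup-∘ k₂' (g ∘ₚ k₁) α ⟩
      lookup k₂' (lookup (g ∘ₚ k₁) α)     ≡⟨ cong (lookup k₂') (trans (lookup-∘ g k₁ α) e) ⟩
      lookup k₂' (lookup k₂ α)            ≡⟨ lookup-∘ k₂' k₂ α ⟨
      lookup (k₂' ∘ₚ k₂) α                ≡⟨ cong (λ t → lookup t α) (inverseˡ k₂ kk₂) ⟩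
      lookup idₚ α                        ≡⟨ lookup-id α ⟩
      α                                   ∎
      where open ≡-Reasoning
    g≡k₂hk₁' : k₂ ∘ₚ (h ∘ₚ k₁') ≡ g
    g≡k₂hk₁' = unconjugate k₂' k₂ g k₁ k₁' (inverseʳ k₂ kk₂) (inverseʳ k₁ kk₁)

  -- The orbit Kα is a block: each g ∈ G either lies in K and preserves it, or moves it off itself.
  orbit-block : IsBlock G orbit
  orbit-block g gg with K? g
  ... | yes kg = inj₁ λ i i∈ → let (k , kk , kα≡i) = ∈⟦ Orbit? ⟧⁻¹ i∈ in
                   ∈⟦ Orbit? ⟧ (g ∘ₚ k , ∘∈ g k kg kk , trans (lookup-∘ g k α) (cong (lookup g) kα≡i))
  ... | no ¬kg = inj₂ λ i i∈ gi∈ → let (k₁ , kk₁ , k₁α≡i) = ∈⟦ Orbit? ⟧⁻¹ i∈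
                                       (k₂ , kk₂ , k₂α≡gi) = ∈⟦ Orbit? ⟧⁻¹ gi∈ in
                   ¬kg (meets⇒∈K g k₁ k₂ gg kk₁ kk₂ (trans (cong (lookup g) k₁α≡i) (sym k₂α≡gi)))

  fixes-or-transitive : IsPrimitive G → (∀ k → K k → Fixes α k) ⊎ (∀ γ → Orbit γ)
  fixes-or-transitive (_ , blocks-trivial) with blocks-trivial orbit orbit-block
  ... | inj₁ small = inj₁ λ k kk → atMostOne small (∈⟦ Orbit? ⟧ (k , kk , refl)) (∈⟦ Orbit? ⟧ (idₚ , id∈ , lookup-id α))
  ... | inj₂ full  = inj₂ λ γ → ∈⟦ Orbit? ⟧⁻¹ (subst (γ ∈_) (sym full) ∈⊤)

module Normaliser {n : ℕ} {G P : PSet n} (G? : Decidable G) (G-grp : IsPermGroup G)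
                  (P? : Decidable P) (P-sub : IsSubgroupOf G P) where
  open DoubleCosets P? P-sub
  open Perms n
  module G = IsSubgroupOf G-grp
  module G⁻¹ = Inverses G-grp

  Normaliser : PSet n
  Normaliser k = G k × ConjInto k

  Normaliser? : Decidable Normaliser
  Normaliser? k = G? k ×-dec dec∀ (λ x → P? x →-dec dec∃ (λ y → P? y ×-dec ((k ∘ₚ x) ≟ₚ (y ∘ₚ k))))

  -- N_G(P) is a subgroup of G; closure under inverses uses finiteness of P (into⇒onto).
  normaliser-subgroup : IsSubgroupOf G Normaliser
  normaliser-subgroup = record
    { ⊆K   = λ _ → proj₁
    ; id∈  = G.id∈ , λ x px → x , px , trans (∘-identityˡ x) (sym (∘-identityʳ x))
    ; ∘∈   = λ k₁ k₂ (gk₁ , into₁) (gk₂ , into₂) → G.∘∈ k₁ k₂ gk₁ gk₂ , compose k₁ k₂ into₁ into₂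
    ; inv∈ = λ k (gk , into) → G⁻¹.inverse k gk , (G⁻¹.inverse-∈ k gk , invert k gk into) ,
                                G⁻¹.inverseʳ k gk , G⁻¹.inverseˡ k gk }
    where
    compose : ∀ k₁ k₂ → ConjInto k₁ → ConjInto k₂ → ConjInto (k₁ ∘ₚ k₂)
    compose k₁ k₂ into₁ into₂ x px =
      let (y , py , k₂x≡yk₂) = into₂ x px
          (y' , py' , k₁y≡y'k₁) = into₁ y py
      in y' , py' , (begin
        (k₁ ∘ₚ k₂) ∘ₚ x  ≡⟨ ∘-assoc k₁ k₂ x ⟩
        k₁ ∘ₚ (k₂ ∘ₚ x)  ≡⟨ cong (k₁ ∘ₚ_) k₂x≡yk₂ ⟩
        k₁ ∘ₚ (y ∘ₚ k₂)  ≡⟨ ∘-assoc k₁ y k₂ ⟨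
        (k₁ ∘ₚ y) ∘ₚ k₂  ≡⟨ cong (_∘ₚ k₂) k₁y≡y'k₁ ⟩
        (y' ∘ₚ k₁) ∘ₚ k₂ ≡⟨ ∘-assoc y' k₁ k₂ ⟩
        y' ∘ₚ (k₁ ∘ₚ k₂) ∎)
      where open ≡-Reasoning
    invert : ∀ k gk → ConjInto k → ConjInto (G⁻¹.inverse k gk)
    invert k gk into = onto⇒into⁻¹ k k' (G⁻¹.inverseʳ k gk) (G⁻¹.inverseˡ k gk)
                         (into⇒onto k k' (G⁻¹.inverseʳ k gk) (G⁻¹.inverseˡ k gk) into)
      where
      k' : Perm n
      k' = G⁻¹.inverse k gk

  module _ {F : PSet n} (F? : Decidable F) (F-resp : F Respects DoubleCoset)
           (N⊆F : ∀ k → Normaliser k → F k) {p a : ℕ} (p-prime : Prime p) (|P| : count P? ≡ p ^ a) where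

    -- A double coset PgP with g ∈ G outside F has size divisible by p^(a+1):
    -- g does not normalise P, so |P ∩ gPg⁻¹| is a proper divisor of |P| = p^a.
    doubleCoset-divisible : ∀ g → G g → ¬ F g → p ^ suc a ∣ count (G? ∩? DoubleCoset? g)
    doubleCoset-divisible g gg ¬Fg = subst (p ^ suc a ∣_) (count-cong (DoubleCoset? g) (G? ∩? DoubleCoset? g) in-G (λ _ → proj₂))
      (cofactor-divisible p-prime a _ (intersectionSize g)
        (trans (doubleCoset-size g g' (G⁻¹.inverseʳ g gg) (G⁻¹.inverseˡ g gg)) (cong₂ _*_ |P| |P|))
        (subst (intersectionSize g ≤_) |P| (intersectionSize≤ g))
        (λ full → ¬Fg (N⊆F g (gg , full-intersection⇒normalises g g' (G⁻¹.inverseʳ g gg) (G⁻¹.inverseˡ g gg)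
                                                                   (trans full (sym |P|))))))
      where
      g' : Perm n
      g' = G⁻¹.inverse g gg
      in-G : ∀ z → DoubleCoset g z → (G ∩ DoubleCoset g) z
      in-G z z∈PgP@(x , px , y , py , refl) =
        G.∘∈ x (g ∘ₚ y) (IsSubgroupOf.⊆K P-sub x px) (G.∘∈ g y gg (IsSubgroupOf.⊆K P-sub y py)) , z∈PgP

    doubleCoset-congruence : ∃ λ m → count G? ≡ count (G? ∩? F?) + m * p ^ suc a
    doubleCoset-congruence =
      Partition.partitionCount _≟ₚ_ (allMaps n) (allMaps-exact n) DoubleCoset? doubleCoset-equivalence F? F-resp
                               (p ^ suc a) G? doubleCoset-divisible

  fixes-image : ∀ α → (∀ x → P x → Fixes α x) → ∀ k → Normaliser k → ∀ x → P x → lookup x (lookup k α) ≡ lookup k α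
  fixes-image α P-fixes k (gk , into) x px =
    let (x' , px' , kx'≡xk) = into⇒onto k (G⁻¹.inverse k gk) (G⁻¹.inverseʳ k gk) (G⁻¹.inverseˡ k gk) into x px in
    begin
    lookup x (lookup k α)   ≡⟨ lookup-∘ x k α ⟨
    lookup (x ∘ₚ k) α       ≡⟨ cong (λ t → lookup t α) kx'≡xk ⟨
    lookup (k ∘ₚ x') α      ≡⟨ lookup-∘ k x' α ⟩
    lookup k (lookup x' α)  ≡⟨ cong (lookup k) (P-fixes x' px') ⟩
    lookup k α              ∎
    where open ≡-Reasoning

  -- In a primitive group, if P ≠ 1 fixes α and is normalised by G_α, then
  -- N_G(P) ≤ G_α: the normaliser contains G_α, hence fixes α or is transitive,
  -- and a transitive normaliser would make P fix every point.
  normaliser-fixes : IsPrimitive G → ∀ α → (∀ x → P x → Fixes α x) →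
                     (∀ h → Stab G α h → ConjInto h) → IsNontrivial P → ∀ k → Normaliser k → Fixes α k
  normaliser-fixes prim α P-fixes Gα-normalises (x , px , x≢id) =
    exclude-transitive (fixes-or-transitive prim)
    where
    open OvergroupOfStabiliser G-grp normaliser-subgroup Normaliser? α (λ h h∈Gα → proj₁ h∈Gα , Gα-normalises h h∈Gα)
    x-trivial : (∀ γ → Orbit γ) → x ≡ idₚ
    x-trivial transitive = ≗⇒≡ λ γ → let (k , nk , kα≡γ) = transitive γ in
      trans (subst (λ t → lookup x t ≡ t) kα≡γ (fixes-image α P-fixes k nk x px)) (sym (lookup-id γ))
    exclude-transitive : (∀ k → Normaliser k → Fixes α k) ⊎ (∀ γ → Orbit γ) → ∀ k → Normaliser k → Fixes α k
    exclude-transitive (inj₁ fixes)      = fixes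
    exclude-transitive (inj₂ transitive) = contradiction (x-trivial transitive) x≢id

lemma2p7 : (n : ℕ) (G : PSet n) (G? : Decidable G) → IsPermGroup G → IsPrimitive G →
    (α : Fin n) (P : PSet n) (P? : Decidable P) →
    IsNormalIn (Stab G α) P → IsSylowOf (Stab? G? α) P? → IsNontrivial P →
    IsSylowOf G? P?
lemma2p7 n G G? G-grp prim α P P? (P≤Gα , Gα-normalises) (_ , p , p-prime , a , |P| , p^a+1∤|Gα|) nontrivial =
  P≤G , p , p-prime , a , |P| , p^a+1∤|G|
  where
  P-fixes : ∀ x → P x → Fixes α x
  P-fixes x px = proj₂ (IsSubgroupOf.⊆K P≤Gα x px)

  P≤G : IsSubgroupOf G P
  P≤G = record { IsSubgroupOf P≤Gα hiding (⊆K) ; ⊆K = λ x px → proj₁ (IsSubgroupOf.⊆K P≤Gα x px) }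

  open Normaliser G? G-grp P? P≤G
  open DoubleCosets P? P≤G using (fixers-resp)

  -- |G| ≡ |G_α| (mod p^(a+1)), since N_G(P) ≤ G_α.
  congruence : ∃ λ m → order G? ≡ order (Stab? G? α) + m * p ^ suc a
  congruence =
    let (m , |G|≡) = doubleCoset-congruence {Fixes α} (Fixes? α) (λ {g} {z} → fixers-resp α P-fixes {g} {z})
                       (normaliser-fixes prim α P-fixes (λ h h∈Gα x px → Gα-normalises h x h∈Gα px) nontrivial)
                       {a = a} p-prime (trans (sym (order≡count P?)) |P|)
    in m , trans (order≡count G?) (trans |G|≡ (cong (_+ m * p ^ suc a) (sym (order≡count (Stab? G? α)))))

  p^a+1∤|G| : ¬ (p ^ suc a ∣ order G?)
  p^a+1∤|G| = let (m , |G|≡) = congruence in ∤-of-congruent m |G|≡ p^a+1∤|Gα|
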